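{- Let $a,b$ be relatively prime integers with $1<a<b$, let $S=\langle a,b\rangle$, let $(u,v)$ be the definitely least solution of $ax+by=1$, let $h=\min I(S)$, and let $L(S)$ be the $|v|\times|u|$ matrix with entries $L(S)(i,j)=h+(i-1)b+(j-1)a$ for $1\le i\le|v|$, $1\le j\le|u|$. Then for all such $i,j$, \[L(S)(i,j)=F(S)-(|u|-j)a-(|v|-i)b.\]
   Context: $\langle a,b\rangle=\{\lambda_1a+\lambda_2b:\lambda_1,\lambda_2\in\mathbb{N}\}$. $F(S)$ is the Frobenius number of $S$, the largest integer not in $S$. $I(S)$ is the set of isolated gaps of $S$ (elements $x\in\mathbb{N}\setminus S$ with $x-1,x+1\in S$). The definitely least solution $(u,v)$ of $ax+by=1$ is the integer solution for which both $|u|$ and $|v|$ are least possible; it is unique, and is the unique solution with $|u|\le b/2$, $|v|\le a/2$. -}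

module Defs where

open import Data.Nat using (ℕ; suc; _≤_) renaming (_+_ to _+ℕ_; _*_ to _*ℕ_)
open import Data.Integer using (ℤ; +_; ∣_∣; _+_; _*_; _-_; 1ℤ)
open import Data.Product using (∃; _×_)
open import Relation.Nullary using (¬_)
open import Relation.Binary.PropositionalEquality using (_≡_)
open import Data.Nat using (_<_)

InS : ℕ → ℕ → ℕ → Set
InS a b x = ∃ λ l₁ → ∃ λ l₂ → x ≡ l₁ *ℕ a +ℕ l₂ *ℕ b

IsFrobenius : ℕ → ℕ → ℕ → Set
IsFrobenius a b F = ¬ InS a b F × (∀ x → F < x → InS a b x)

IsIsolatedGap : ℕ → ℕ → ℕ → Set
IsIsolatedGap a b x =
  ¬ InS a b x × InS a b (suc x) × (∃ λ y → suc y ≡ x × InS a b y)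

IsMinIsolatedGap : ℕ → ℕ → ℕ → Set
IsMinIsolatedGap a b h = IsIsolatedGap a b h × (∀ x → IsIsolatedGap a b x → h ≤ x)

DefinitelyLeast : ℕ → ℕ → ℤ → ℤ → Set
DefinitelyLeast a b u v =
  (+ a) * u + (+ b) * v ≡ 1ℤ ×
  (∀ x y → (+ a) * x + (+ b) * y ≡ 1ℤ → ∣ u ∣ ≤ ∣ x ∣ × ∣ v ∣ ≤ ∣ y ∣)

L : ℕ → ℕ → ℕ → ℕ → ℕ → ℤ
L a b h i j = + h + (+ i - 1ℤ) * + b + (+ j - 1ℤ) * + a

{-# OPTIONS --safe #-}
-- Write U = |u| and V = |v|. Exactly one of u, v is negative; by the symmetry a ↔ b say u = −U,
-- so bV = 1 + aU, and comparing (u, v) with the solution (u + b, v − a) gives 2U ≤ b and 2V ≤ a.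
-- Then g = (a − 2V)b + 1 is an isolated gap: g − 1 = (a − 2V)b and g + 1 = (b − 2U)a lie in S,
-- while g + Ua + Vb = ab keeps g out of S. Conversely, let x be an isolated gap with
-- x + 1 = pa + qb and x − 1 = ra + sb. Then q < V, since otherwise x = (p + U)a + (q − V)b.
-- Adding 2bV = 2 + 2aU gives ra + (s + 2V)b = (p + 2U)a + qb, and coprimality forces
-- s + 2V ≥ q + a, so x ≥ g. Hence h + Ua + Vb = ab = F + a + b by Sylvester's formula
-- F = ab − a − b, and the stated formula for L(S)(i, j) is a rearrangement of this identity.
module Submission where

open import Defs
open import Data.Nat.Coprimality using (Coprime)
open import Relation.Binary.PropositionalEquality using (_≡_)

module TwoGeneratorSemigroup where

  open import Data.Nat using (ℕ; zero; suc; _+_; _*_; _≤_; _<_; z≤n; s≤s; _≤?_; NonZero; >-nonZero)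
  open import Data.Nat.Properties
  open import Data.Nat.Coprimality using (coprime-divisor) renaming (sym to sym-coprime)
  open import Data.Nat.Divisibility using (_∣_; divides; ∣m+n∣m⇒∣n; ∣⇒≤)
  open import Data.Nat.DivMod using (_%_; _/_; m≡m%n+[m/n]*n; m%n<n)
  open import Data.Nat.Tactic.RingSolver using (solve)
  open import Data.List using (_∷_; [])
  open import Data.Product using (_,_)
  open import Data.Sum using (_⊎_; inj₁; inj₂)
  open import Data.Empty using (⊥-elim)
  open import Function using (_∘_)
  open import Relation.Nullary using (¬_; yes; no)
  open import Relation.Binary.Definitions using (tri<; tri≈; tri>)
  open import Relation.Binary.PropositionalEquality
    using (_≢_; refl; sym; trans; cong; subst; module ≡-Reasoning)

  InS-swap : ∀ {a b x} → InS a b x → InS b a x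
  InS-swap (k , l , refl) = l , k , +-comm (k * _) (l * _)

  IsIsolatedGap-swap : ∀ {a b x} → IsIsolatedGap a b x → IsIsolatedGap b a x
  IsIsolatedGap-swap (x∉S , 1+x∈S , y , 1+y≡x , y∈S) =
    x∉S ∘ InS-swap , InS-swap 1+x∈S , y , 1+y≡x , InS-swap y∈S

  IsMinIsolatedGap-swap : ∀ {a b h} → IsMinIsolatedGap a b h → IsMinIsolatedGap b a h
  IsMinIsolatedGap-swap (h-gap , h-least) =
    IsIsolatedGap-swap h-gap , λ x x-gap → h-least x (IsIsolatedGap-swap x-gap)

  IsFrobenius-swap : ∀ {a b F} → IsFrobenius a b F → IsFrobenius b a F
  IsFrobenius-swap (F∉S , above-F∈S) = F∉S ∘ InS-swap , λ x F<x → InS-swap (above-F∈S x F<x)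

  coprime-∣⇒≤ : ∀ {a b c} → Coprime a b → a ∣ c * b → 1 ≤ c → a ≤ c
  coprime-∣⇒≤ {a} {b} {c} coprime a∣cb 1≤c =
    ∣⇒≤ {{>-nonZero 1≤c}} (coprime-divisor coprime (subst (a ∣_) (*-comm c b) a∣cb))

  ma+qb≡ra+tb⇒q+a≤t : ∀ {a b m q r t} → Coprime a b →
                      m * a + q * b ≡ r * a + t * b → q < t → q + a ≤ t
  ma+qb≡ra+tb⇒q+a≤t {a} {b} {m} {q} {r} coprime eq q<t with m≤n⇒∃[o]m+o≡n q<t
  ... | c , refl = subst (q + a ≤_) (+-suc q c) (+-monoʳ-≤ q a≤1+c)
    where
      ma≡ra+[1+c]b : m * a ≡ r * a + suc c * b
      ma≡ra+[1+c]b = +-cancelʳ-≡ (q * b) _ _ (begin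
        m * a + q * b             ≡⟨ eq ⟩
        r * a + suc (q + c) * b   ≡⟨ solve (r ∷ a ∷ q ∷ c ∷ b ∷ []) ⟩
        r * a + suc c * b + q * b ∎)
        where open ≡-Reasoning

      a≤1+c : a ≤ suc c
      a≤1+c = coprime-∣⇒≤ coprime
        (∣m+n∣m⇒∣n (divides m (sym ma≡ra+[1+c]b)) (divides r refl)) (s≤s z≤n)

  x+ma+nb≡ab⇒x∉S : ∀ {a b m n x} → Coprime a b → 1 ≤ a → 1 ≤ m → 1 ≤ n →
                   x + m * a + n * b ≡ a * b → ¬ InS a b x
  x+ma+nb≡ab⇒x∉S {a} {b} {m} {n} coprime 1≤a 1≤m 1≤n eq (k , l , refl) = <-irrefl refl ab<ab
    where
      eq′ : (k + m) * a + (l + n) * b ≡ a * b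
      eq′ = begin
        (k + m) * a + (l + n) * b       ≡⟨ solve (k ∷ m ∷ a ∷ l ∷ n ∷ b ∷ []) ⟩
        k * a + l * b + m * a + n * b   ≡⟨ eq ⟩
        a * b                           ∎
        where open ≡-Reasoning

      a≤l+n : a ≤ l + n
      a≤l+n = coprime-∣⇒≤ coprime
        (∣m+n∣m⇒∣n (divides b (trans eq′ (*-comm a b))) (divides (k + m) refl))
        (≤-trans 1≤n (m≤n+m n l))

      ab<ab : a * b < a * b
      ab<ab = begin-strict
        a * b                       ≤⟨ *-monoˡ-≤ b a≤l+n ⟩
        (l + n) * b                 <⟨ m<n+m _ (*-mono-≤ (≤-trans 1≤m (m≤n+m m k)) 1≤a) ⟩
        (k + m) * a + (l + n) * b   ≡⟨ eq′ ⟩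
        a * b                       ∎
        where open ≤-Reasoning

  rb+aX≡n+aY⇒InS : ∀ {a b r} X Y n → r < a → r * b + a * X ≡ n + a * Y →
                   a * b < n + a + b → InS a b n
  rb+aX≡n+aY⇒InS {a} {b} {r} X Y n r<a eq ab<n+a+b with Y ≤? X
  ... | yes Y≤X with m≤n⇒∃[o]m+o≡n Y≤X
  ...   | y , refl = y , r , sym (+-cancelʳ-≡ (a * Y) _ _ (begin
          y * a + r * b + a * Y   ≡⟨ solve (y ∷ a ∷ r ∷ b ∷ Y ∷ []) ⟩
          r * b + a * (Y + y)     ≡⟨ eq ⟩
          n + a * Y               ∎))
    where open ≡-Reasoning
  rb+aX≡n+aY⇒InS {a} {b} {r} X Y n r<a eq ab<n+a+b | no Y≰X with m≤n⇒∃[o]m+o≡n (≰⇒> Y≰X)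
  ...   | z , refl = ⊥-elim (<⇒≱ ab<n+a+b n+a+b≤ab)
    where
      rb≡n+a[1+z] : r * b ≡ n + a * suc z
      rb≡n+a[1+z] = +-cancelʳ-≡ (a * X) _ _ (begin
        r * b + a * X             ≡⟨ eq ⟩
        n + a * suc (X + z)       ≡⟨ solve (n ∷ a ∷ X ∷ z ∷ []) ⟩
        n + a * suc z + a * X     ∎)
        where open ≡-Reasoning

      n+a+b≤ab : n + a + b ≤ a * b
      n+a+b≤ab = begin
        n + a + b                 ≤⟨ +-monoˡ-≤ b (+-monoʳ-≤ n (m≤m*n a (suc z))) ⟩
        n + a * suc z + b         ≡⟨ cong (_+ b) (sym rb≡n+a[1+z]) ⟩
        r * b + b                 ≡⟨ +-comm (r * b) b ⟩
        suc r * b                 ≤⟨ *-monoˡ-≤ b r<a ⟩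
        a * b                     ∎
        where open ≤-Reasoning

  -- w inverts b modulo a, so the residue r of n w modulo a satisfies r b ≡ n (mod a).
  ab<n+a+b⇒InS : ∀ {a b w k} n .{{_ : NonZero a}} → b * w ≡ 1 + a * k →
                 a * b < n + a + b → InS a b n
  ab<n+a+b⇒InS {a} {b} {w} {k} n bezout
    with n * w % a | m%n<n (n * w) a | n * w / a | m≡m%n+[m/n]*n (n * w) a
  ... | r | r<a | q | nw≡r+qa = rb+aX≡n+aY⇒InS (q * b) (n * k) n r<a (begin
    r * b + a * (q * b)   ≡⟨ solve (r ∷ b ∷ a ∷ q ∷ []) ⟩
    (r + q * a) * b       ≡⟨ cong (_* b) (sym nw≡r+qa) ⟩
    n * w * b             ≡⟨ solve (n ∷ w ∷ b ∷ []) ⟩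
    n * (b * w)           ≡⟨ cong (n *_) bezout ⟩
    n * (1 + a * k)       ≡⟨ solve (n ∷ a ∷ k ∷ []) ⟩
    n + a * (n * k)       ∎)
    where open ≡-Reasoning

  IsFrobenius⇒F+a+b≡ab : ∀ {a b w k F} → Coprime a b → 1 ≤ a → b * w ≡ 1 + a * k →
                         IsFrobenius a b F → F + a + b ≡ a * b
  IsFrobenius⇒F+a+b≡ab {a} {b} {F = F} coprime 1≤a bezout (F∉S , above-F∈S)
    with <-cmp (F + a + b) (a * b)
  ... | tri≈ _ F+a+b≡ab _ = F+a+b≡ab
  ... | tri> _ _ ab<F+a+b = ⊥-elim (F∉S (ab<n+a+b⇒InS F {{>-nonZero 1≤a}} bezout ab<F+a+b))
  ... | tri< F+a+b<ab _ _ with m≤n⇒∃[o]m+o≡n F+a+b<ab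
  ...   | d , F+a+b+1+d≡ab =
    ⊥-elim (x+ma+nb≡ab⇒x∉S coprime 1≤a ≤-refl ≤-refl x+a+b≡ab (above-F∈S x (m<m+n F (s≤s z≤n))))
    where
      x : ℕ
      x = F + suc d
      x+a+b≡ab : x + 1 * a + 1 * b ≡ a * b
      x+a+b≡ab = begin
        F + suc d + 1 * a + 1 * b ≡⟨ solve (F ∷ d ∷ a ∷ b ∷ []) ⟩
        suc (F + a + b) + d       ≡⟨ F+a+b+1+d≡ab ⟩
        a * b                     ∎
        where open ≡-Reasoning

  record BalancedSolution (a b U V : ℕ) : Set where
    field
      bezout : b * V ≡ 1 + a * U
      1≤U    : 1 ≤ U
      U+U≤b  : U + U ≤ b
      V+V≤a  : V + V ≤ a

  module BalancedSolutionGap {a b U V A B : ℕ} (coprime : Coprime a b)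
    (bezout : b * V ≡ 1 + a * U) (1≤U : 1 ≤ U)
    (a≡V+V+A : a ≡ V + V + A) (b≡U+U+B : b ≡ U + U + B) where

    1≤V : 1 ≤ V
    1≤V = n≢0⇒n>0 λ V≡0 →
      0≢1+n (trans (sym (*-zeroʳ b)) (subst (λ v → b * v ≡ 1 + a * U) V≡0 bezout))

    1≤a : 1 ≤ a
    1≤a = subst (1 ≤_) (sym a≡V+V+A) (≤-trans 1≤V (≤-trans (m≤m+n V V) (m≤m+n (V + V) A)))

    gap : ℕ
    gap = suc (A * b)

    gap+Ua+Vb≡ab : gap + U * a + V * b ≡ a * b
    gap+Ua+Vb≡ab = begin
      suc (A * b) + U * a + V * b   ≡⟨ solve (A ∷ b ∷ U ∷ a ∷ V ∷ []) ⟩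
      A * b + V * b + (1 + a * U)   ≡⟨ cong (A * b + V * b +_) (sym bezout) ⟩
      A * b + V * b + b * V         ≡⟨ solve (A ∷ b ∷ V ∷ []) ⟩
      (V + V + A) * b               ≡⟨ cong (_* b) (sym a≡V+V+A) ⟩
      a * b                         ∎
      where open ≡-Reasoning

    1+gap≡Ba : suc gap ≡ B * a
    1+gap≡Ba = +-cancelʳ-≡ (a * U + a * U) _ _ (begin
      suc (suc (A * b)) + (a * U + a * U)   ≡⟨ solve (A ∷ b ∷ a ∷ U ∷ []) ⟩
      A * b + ((1 + a * U) + (1 + a * U))   ≡⟨ cong (λ t → A * b + (t + t)) (sym bezout) ⟩
      A * b + (b * V + b * V)               ≡⟨ solve (A ∷ b ∷ V ∷ []) ⟩
      (V + V + A) * b                       ≡⟨ cong (_* b) (sym a≡V+V+A) ⟩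
      a * b                                 ≡⟨ cong (a *_) b≡U+U+B ⟩
      a * (U + U + B)                       ≡⟨ solve (a ∷ U ∷ B ∷ []) ⟩
      B * a + (a * U + a * U)               ∎)
      where open ≡-Reasoning

    gap-isolated : IsIsolatedGap a b gap
    gap-isolated =
      x+ma+nb≡ab⇒x∉S coprime 1≤a 1≤U 1≤V gap+Ua+Vb≡ab ,
      (B , 0 , trans 1+gap≡Ba (sym (+-identityʳ (B * a)))) ,
      (A * b , refl , 0 , A , refl)

    1+x≡pa+qb∧V≤q⇒x∈S : ∀ {x p q} → suc x ≡ p * a + q * b → V ≤ q → InS a b x
    1+x≡pa+qb∧V≤q⇒x∈S {x} {p} {q} 1+x≡pa+qb V≤q with m≤n⇒∃[o]m+o≡n V≤q
    ... | t , V+t≡q = p + U , t , suc-injective (begin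
      suc x                         ≡⟨ 1+x≡pa+qb ⟩
      p * a + q * b                 ≡⟨ cong (λ z → p * a + z * b) (sym V+t≡q) ⟩
      p * a + (V + t) * b           ≡⟨ solve (p ∷ a ∷ V ∷ t ∷ b ∷ []) ⟩
      p * a + t * b + b * V         ≡⟨ cong (p * a + t * b +_) bezout ⟩
      p * a + t * b + (1 + a * U)   ≡⟨ solve (p ∷ a ∷ t ∷ b ∷ U ∷ []) ⟩
      suc ((p + U) * a + t * b)     ∎)
      where open ≡-Reasoning

    isolatedGap⇒gap≤ : ∀ {x} → IsIsolatedGap a b x → gap ≤ x
    isolatedGap⇒gap≤ {x} (x∉S , (p , q , 1+x≡pa+qb) , y , 1+y≡x , (r , s , y≡ra+sb)) =
      subst (gap ≤_) (trans (cong suc (sym y≡ra+sb)) 1+y≡x)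
        (s≤s (≤-trans (*-monoˡ-≤ b A≤s) (m≤n+m (s * b) (r * a))))
      where
        two-representations : (p + (U + U)) * a + q * b ≡ r * a + (s + (V + V)) * b
        two-representations = begin
          (p + (U + U)) * a + q * b         ≡⟨ solve (p ∷ U ∷ a ∷ q ∷ b ∷ []) ⟩
          p * a + q * b + (a * U + a * U)   ≡⟨ cong (_+ (a * U + a * U)) (sym 1+x≡pa+qb) ⟩
          suc x + (a * U + a * U)           ≡⟨ cong (λ z → suc z + (a * U + a * U)) (sym 1+y≡x) ⟩
          suc (suc y) + (a * U + a * U)     ≡⟨ solve (y ∷ a ∷ U ∷ []) ⟩
          y + ((1 + a * U) + (1 + a * U))   ≡⟨ cong (λ t → y + (t + t)) (sym bezout) ⟩
          y + (b * V + b * V)               ≡⟨ cong (_+ (b * V + b * V)) y≡ra+sb ⟩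
          r * a + s * b + (b * V + b * V)   ≡⟨ solve (r ∷ a ∷ s ∷ b ∷ V ∷ []) ⟩
          r * a + (s + (V + V)) * b         ∎
          where open ≡-Reasoning

        q<s+[V+V] : q < s + (V + V)
        q<s+[V+V] = <-≤-trans (≰⇒> (x∉S ∘ 1+x≡pa+qb∧V≤q⇒x∈S {p = p} 1+x≡pa+qb))
                              (≤-trans (m≤m+n V V) (m≤n+m (V + V) s))

        A≤s : A ≤ s
        A≤s = +-cancelʳ-≤ (V + V) A s (begin
          A + (V + V)   ≡⟨ +-comm A (V + V) ⟩
          V + V + A     ≡⟨ sym a≡V+V+A ⟩
          a             ≤⟨ m≤n+m a q ⟩
          q + a         ≤⟨ ma+qb≡ra+tb⇒q+a≤t {m = p + (U + U)} {r = r}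
                               coprime two-representations q<s+[V+V] ⟩
          s + (V + V)   ∎)
          where open ≤-Reasoning

    minIsolatedGap≡gap : ∀ {h} → IsMinIsolatedGap a b h → h ≡ gap
    minIsolatedGap≡gap (h-gap , h-least) =
      ≤-antisym (h-least gap gap-isolated) (isolatedGap⇒gap≤ h-gap)

  balanced⇒h+Ua+Vb≡F+a+b : ∀ {a b U V h F} → Coprime a b → BalancedSolution a b U V →
                           IsMinIsolatedGap a b h → IsFrobenius a b F → h + U * a + V * b ≡ F + a + b
  balanced⇒h+Ua+Vb≡F+a+b {a} {b} {U} {V} {h} {F} coprime sol h-min F-frob = begin
    h + U * a + V * b   ≡⟨ cong (λ x → x + U * a + V * b) (minIsolatedGap≡gap h-min) ⟩
    gap + U * a + V * b ≡⟨ gap+Ua+Vb≡ab ⟩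
    a * b               ≡⟨ sym (IsFrobenius⇒F+a+b≡ab coprime 1≤a bezout F-frob) ⟩
    F + a + b           ∎
    where
      open ≡-Reasoning
      open BalancedSolution sol
      open BalancedSolutionGap coprime bezout 1≤U (sym (m+[n∸m]≡n V+V≤a)) (sym (m+[n∸m]≡n U+U≤b))

  balanced-either⇒h+Ua+Vb≡F+a+b : ∀ {a b U V h F} → Coprime a b →
    BalancedSolution a b U V ⊎ BalancedSolution b a V U →
    IsMinIsolatedGap a b h → IsFrobenius a b F → h + U * a + V * b ≡ F + a + b
  balanced-either⇒h+Ua+Vb≡F+a+b coprime (inj₁ sol) h-min F-frob =
    balanced⇒h+Ua+Vb≡F+a+b coprime sol h-min F-frob
  balanced-either⇒h+Ua+Vb≡F+a+b {a} {b} {U} {V} {h} {F} coprime (inj₂ sol) h-min F-frob = begin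
    h + U * a + V * b   ≡⟨ solve (h ∷ U ∷ a ∷ V ∷ b ∷ []) ⟩
    h + V * b + U * a   ≡⟨ balanced⇒h+Ua+Vb≡F+a+b (sym-coprime coprime) sol
                             (IsMinIsolatedGap-swap h-min) (IsFrobenius-swap F-frob) ⟩
    F + b + a           ≡⟨ solve (F ∷ b ∷ a ∷ []) ⟩
    F + a + b           ∎
    where open ≡-Reasoning

  ax+by≢1 : ∀ {a b x y} → 1 < a → 1 < b → a * x + b * y ≢ 1
  ax+by≢1 {a} {b} {zero} {y} 1<a 1<b ax+by≡1 =
    <⇒≢ 1<b (sym (m*n≡1⇒m≡1 b y (trans (cong (_+ b * y) (sym (*-zeroʳ a))) ax+by≡1)))
  ax+by≢1 {a} {b} {suc x} {y} 1<a 1<b ax+by≡1 =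
    <⇒≱ 1<a (subst (a ≤_) ax+by≡1 (≤-trans (m≤m*n a (suc x)) (m≤m+n (a * suc x) (b * y))))

open TwoGeneratorSemigroup using (BalancedSolution; balanced-either⇒h+Ua+Vb≡F+a+b; ax+by≢1)

import Data.Nat as ℕ
import Data.Nat.Properties as ℕ
open import Data.Nat using (ℕ; suc; _≤_; _<_; z≤n; s≤s; _≤?_)
open import Data.Integer using (ℤ; +_; -[1+_]; ∣_∣; _+_; _*_; _-_; -_; _⊖_; 1ℤ)
open import Data.Integer.Properties using (+-injective; pos-+; pos-*; m-n≡m⊖n; ∣m⊖n∣≡∣n⊖m∣; ∣⊖∣-≤; ∣⊖∣-<)
import Data.Integer.Properties as ℤ
open import Data.Integer.Tactic.RingSolver using (solve)
open import Data.List using (_∷_; [])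
open import Data.Product using (_,_; _×_; proj₁; proj₂; swap)
open import Data.Sum using (_⊎_; inj₁; inj₂)
open import Data.Empty using (⊥-elim)
open import Relation.Nullary using (yes; no; contradiction)
open import Relation.Binary.PropositionalEquality using (sym; trans; cong; cong₂; subst; module ≡-Reasoning)

n≤∣m⊖n∣⇒n+n≤m : ∀ {m n} → 1 ≤ m → n ≤ ∣ m ⊖ n ∣ → n ℕ.+ n ≤ m
n≤∣m⊖n∣⇒n+n≤m {m} {n} 1≤m n≤∣m⊖n∣ with n ≤? m
... | yes n≤m = subst (n ℕ.+ n ≤_) (ℕ.m∸n+n≡m n≤m)
      (ℕ.+-monoˡ-≤ n (subst (n ≤_) (trans (∣m⊖n∣≡∣n⊖m∣ m n) (∣⊖∣-≤ n≤m)) n≤∣m⊖n∣))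
... | no n≰m = contradiction n≤∣m⊖n∣ (ℕ.<⇒≱ ∣m⊖n∣<n)
  where
    m<n : m < n
    m<n = ℕ.≰⇒> n≰m
    ∣m⊖n∣<n : ∣ m ⊖ n ∣ < n
    ∣m⊖n∣<n = subst (ℕ._< n) (sym (∣⊖∣-< m<n)) (ℕ.∸-monoʳ-< 1≤m (ℕ.<⇒≤ m<n))

DefinitelyLeast-swap : ∀ {a b u v} → DefinitelyLeast a b u v → DefinitelyLeast b a v u
DefinitelyLeast-swap {a} {b} {u} {v} (bezout , least) =
  trans (ℤ.+-comm (+ b * v) (+ a * u)) bezout ,
  λ x y by+ax≡1 → swap (least y x (trans (ℤ.+-comm (+ a * y) (+ b * x)) by+ax≡1))

a[u+b]+b[v-a]≡au+bv : ∀ a b u v → a * (u + b) + b * (v - a) ≡ a * u + b * v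
a[u+b]+b[v-a]≡au+bv a b u v = solve (a ∷ b ∷ u ∷ v ∷ [])

DefinitelyLeast⇒shift-bound : ∀ {a b u v} → DefinitelyLeast a b u v →
                              ∣ u ∣ ≤ ∣ u + + b ∣ × ∣ v ∣ ≤ ∣ v - + a ∣
DefinitelyLeast⇒shift-bound {a} {b} {u} {v} (bezout , least) =
  least (u + + b) (v - + a) (trans (a[u+b]+b[v-a]≡au+bv (+ a) (+ b) u v) bezout)

bv≡[a[-u]+bv]+au : ∀ a b u v → b * v ≡ (a * (- u) + b * v) + a * u
bv≡[a[-u]+bv]+au a b u v = solve (a ∷ b ∷ u ∷ v ∷ [])

a[-1-U]+bV≡1⇒bV≡1+a[1+U] : ∀ {a b U V} → + a * -[1+ U ] + + b * + V ≡ 1ℤ →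
                           b ℕ.* V ≡ 1 ℕ.+ a ℕ.* suc U
a[-1-U]+bV≡1⇒bV≡1+a[1+U] {a} {b} {U} {V} bezout = +-injective (begin
  + (b ℕ.* V)                                    ≡⟨ pos-* b V ⟩
  + b * + V                                      ≡⟨ bv≡[a[-u]+bv]+au (+ a) (+ b) (+ suc U) (+ V) ⟩
  (+ a * -[1+ U ] + + b * + V) + + a * + suc U   ≡⟨ cong (_+ + a * + suc U) bezout ⟩
  1ℤ + + a * + suc U                             ≡⟨ cong (λ t → 1ℤ + t) (sym (pos-* a (suc U))) ⟩
  1ℤ + + (a ℕ.* suc U)                           ≡⟨ sym (pos-+ 1 (a ℕ.* suc U)) ⟩
  + (1 ℕ.+ a ℕ.* suc U)                          ∎)
  where open ≡-Reasoning

DefinitelyLeast⇒balanced : ∀ {a b U V} → 1 ≤ a → 1 ≤ b → DefinitelyLeast a b -[1+ U ] (+ V) →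
                           BalancedSolution a b (suc U) V
DefinitelyLeast⇒balanced {a} {b} {U} {V} 1≤a 1≤b least@(bezout , _) = record
  { bezout = a[-1-U]+bV≡1⇒bV≡1+a[1+U] {a} {b} bezout
  ; 1≤U    = s≤s z≤n
  ; U+U≤b  = n≤∣m⊖n∣⇒n+n≤m 1≤b (proj₁ shift-bound)
  ; V+V≤a  = n≤∣m⊖n∣⇒n+n≤m 1≤a
               (subst (V ≤_) (trans (cong ∣_∣ (m-n≡m⊖n V a)) (∣m⊖n∣≡∣n⊖m∣ V a)) (proj₂ shift-bound))
  }
  where
    shift-bound : suc U ≤ ∣ -[1+ U ] + + b ∣ × V ≤ ∣ + V - + a ∣
    shift-bound = DefinitelyLeast⇒shift-bound {a} {b} least

DefinitelyLeast⇒balanced-either : ∀ {a b u v} → 1 < a → 1 < b → DefinitelyLeast a b u v →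
  BalancedSolution a b (∣ u ∣) (∣ v ∣) ⊎ BalancedSolution b a (∣ v ∣) (∣ u ∣)
DefinitelyLeast⇒balanced-either {a} {b} {+ U} {+ V} 1<a 1<b (bezout , _) =
  ⊥-elim (ax+by≢1 1<a 1<b (+-injective (trans (pos-+ (a ℕ.* U) (b ℕ.* V))
    (trans (cong₂ _+_ (pos-* a U) (pos-* b V)) bezout))))
-- Once a and b are successors, a u + b v normalises to a negative constructor.
DefinitelyLeast⇒balanced-either {u = -[1+ U ]} {v = -[1+ V ]} (s≤s (s≤s z≤n)) (s≤s (s≤s z≤n)) (() , _)
DefinitelyLeast⇒balanced-either {u = -[1+ U ]} {v = + V} 1<a 1<b least =
  inj₁ (DefinitelyLeast⇒balanced (ℕ.<⇒≤ 1<a) (ℕ.<⇒≤ 1<b) least)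
DefinitelyLeast⇒balanced-either {a} {b} {+ U} {v = -[1+ V ]} 1<a 1<b least =
  inj₂ (DefinitelyLeast⇒balanced (ℕ.<⇒≤ 1<b) (ℕ.<⇒≤ 1<a) (DefinitelyLeast-swap {a} {b} least))

L-entry-identity : ∀ h F a b U V i j → h + U * a + V * b ≡ F + a + b →
                   h + (i - 1ℤ) * b + (j - 1ℤ) * a ≡ F - (U - j) * a - (V - i) * b
L-entry-identity h F a b U V i j key = begin
  h + (i - 1ℤ) * b + (j - 1ℤ) * a
    ≡⟨ solve (h ∷ F ∷ a ∷ b ∷ U ∷ V ∷ i ∷ j ∷ []) ⟩
  F - (U - j) * a - (V - i) * b + (h + U * a + V * b - (F + a + b))
    ≡⟨ cong (λ t → F - (U - j) * a - (V - i) * b + (t - (F + a + b))) key ⟩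
  F - (U - j) * a - (V - i) * b + (F + a + b - (F + a + b))
    ≡⟨ solve (F ∷ a ∷ b ∷ U ∷ V ∷ i ∷ j ∷ []) ⟩
  F - (U - j) * a - (V - i) * b
    ∎
  where open ≡-Reasoning

L≡F-[U-j]a-[V-i]b : ∀ {a b h F U V} → h ℕ.+ U ℕ.* a ℕ.+ V ℕ.* b ≡ F ℕ.+ a ℕ.+ b →
                    ∀ i j → L a b h i j ≡ + F - (+ U - + j) * + a - (+ V - + i) * + b
L≡F-[U-j]a-[V-i]b {a} {b} {h} {F} {U} {V} key i j =
  L-entry-identity (+ h) (+ F) (+ a) (+ b) (+ U) (+ V) (+ i) (+ j) (begin
    + h + + U * + a + + V * + b         ≡⟨ cong (λ t → + h + t + + V * + b) (sym (pos-* U a)) ⟩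
    + h + + (U ℕ.* a) + + V * + b       ≡⟨ cong₂ _+_ (sym (pos-+ h (U ℕ.* a))) (sym (pos-* V b)) ⟩
    + (h ℕ.+ U ℕ.* a) + + (V ℕ.* b)     ≡⟨ sym (pos-+ (h ℕ.+ U ℕ.* a) (V ℕ.* b)) ⟩
    + (h ℕ.+ U ℕ.* a ℕ.+ V ℕ.* b)       ≡⟨ cong +_ key ⟩
    + (F ℕ.+ a ℕ.+ b)                   ≡⟨ pos-+ (F ℕ.+ a) b ⟩
    + (F ℕ.+ a) + + b                   ≡⟨ cong (_+ + b) (pos-+ F a) ⟩
    + F + + a + + b                     ∎)
  where open ≡-Reasoning

-- The formula holds for all i and j.
corollary4p12 : (a b : ℕ) → 1 < a → a < b → Coprime a b →
    (u v : ℤ) → DefinitelyLeast a b u v →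
    (h : ℕ) → IsMinIsolatedGap a b h →
    (F : ℕ) → IsFrobenius a b F →
    (i j : ℕ) → 1 ≤ i → i ≤ ∣ v ∣ → 1 ≤ j → j ≤ ∣ u ∣ →
    L a b h i j ≡ + F - (+ ∣ u ∣ - + j) * + a - (+ ∣ v ∣ - + i) * + b
corollary4p12 a b 1<a a<b coprime u v least h h-min F F-frob i j _ _ _ _ =
  L≡F-[U-j]a-[V-i]b (balanced-either⇒h+Ua+Vb≡F+a+b coprime balanced h-min F-frob) i j
  where
    balanced : BalancedSolution a b (∣ u ∣) (∣ v ∣) ⊎ BalancedSolution b a (∣ v ∣) (∣ u ∣)
    balanced = DefinitelyLeast⇒balanced-either 1<a (ℕ.<-trans 1<a a<b) least
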